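{- Let $k\ge 0$ and $n\ge 0$ be integers. Let $G$ be the graph obtained from the path graph $P_{k+1}$ (vertices $1,\dots,k+1$, edges $\{i,i+1\}$) by adjoining a loop at the endpoint $1$. Then $a(n,2k+1)$ equals the number of walks of length $n$ in $G$ that start and end at vertex $1$.
   Context: Up-step $U:(i,j)\to(i+1,j+1)$, down-step $D:(i,j)\to(i+1,j-1)$. For integers $n,k\ge 0$, $A_{n,k}$ is the set of lattice paths of length $n$ consisting of $U$ and $D$ steps that start at $(0,0)$, end at height $0$ or $-1$, and stay in the strip $-\lfloor (k+1)/2\rfloor\le y\le \lfloor k/2\rfloor$. Set $a(n,k)=|A_{n,k}|$. A walk of length $n$ is a sequence of $n$ consecutive edge traversals; traversing the loop counts as one step. -}

module Defs where

open import Data.Nat using (ℕ; zero; suc; _+_; _*_; _/_)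
open import Data.Integer as ℤ using (ℤ; +_; -_)
open import Data.Fin using (Fin; zero; suc)
open import Data.List using (List; []; _∷_; length; filter; map; concatMap; allFin)
open import Data.Product using (_×_; _,_)
open import Data.Sum using (_⊎_)
open import Data.Bool using (Bool; true; false)
open import Relation.Binary.PropositionalEquality using (_≡_)
open import Relation.Nullary using (Dec; yes; no)
open import Relation.Nullary.Decidable using (_×-dec_; _⊎-dec_)
import Data.Integer.Properties as ℤP
import Data.Fin.Properties as FinP

data Step : Set where
  U D : Step

allSeqs : ℕ → List (List Step)
allSeqs zero    = [] ∷ []
allSeqs (suc n) = concatMap (λ s → (U ∷ s) ∷ (D ∷ s) ∷ []) (allSeqs n)

stepVal : Step → ℤ
stepVal U = + 1
stepVal D = - (+ 1)

StaysIn : ℤ → ℤ → ℤ → List Step → Set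
StaysIn lo hi h []       = (lo ℤ.≤ h) × (h ℤ.≤ hi)
StaysIn lo hi h (s ∷ ss) = ((lo ℤ.≤ h) × (h ℤ.≤ hi)) × StaysIn lo hi (h ℤ.+ stepVal s) ss

staysIn? : ∀ lo hi h ss → Dec (StaysIn lo hi h ss)
staysIn? lo hi h []       = (lo ℤ.≤? h) ×-dec (h ℤ.≤? hi)
staysIn? lo hi h (s ∷ ss) = ((lo ℤ.≤? h) ×-dec (h ℤ.≤? hi)) ×-dec staysIn? lo hi (h ℤ.+ stepVal s) ss

endHeight : ℤ → List Step → ℤ
endHeight h []       = h
endHeight h (s ∷ ss) = endHeight (h ℤ.+ stepVal s) ss

InA : ℕ → List Step → Set
InA k p = ((endHeight (+ 0) p ≡ + 0) ⊎ (endHeight (+ 0) p ≡ - (+ 1)))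
        × StaysIn (- (+ (suc k / 2))) (+ (k / 2)) (+ 0) p

inA? : ∀ k p → Dec (InA k p)
inA? k p = ((endHeight (+ 0) p ℤ.≟ + 0) ⊎-dec (endHeight (+ 0) p ℤ.≟ - (+ 1)))
           ×-dec staysIn? (- (+ (suc k / 2))) (+ (k / 2)) (+ 0) p

a : ℕ → ℕ → ℕ
a n k = length (filter (inA? k) (allSeqs n))

-- The graph G: path P_{k+1} on vertices 1..k+1 (here Fin (suc k),
-- vertex 1 = zero) with a loop at vertex 1.

Adj : (k : ℕ) → Fin (suc k) → Fin (suc k) → Set
Adj k i j = (Data.Fin.toℕ j ≡ suc (Data.Fin.toℕ i))
          ⊎ (Data.Fin.toℕ i ≡ suc (Data.Fin.toℕ j))
          ⊎ ((i ≡ zero) × (j ≡ zero))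

adj? : ∀ k i j → Dec (Adj k i j)
adj? k i j = (Data.Fin.toℕ j Data.Nat.≟ suc (Data.Fin.toℕ i))
           ⊎-dec ((Data.Fin.toℕ i Data.Nat.≟ suc (Data.Fin.toℕ j))
           ⊎-dec ((i FinP.≟ zero) ×-dec (j FinP.≟ zero)))

allVSeqs : (k m : ℕ) → List (List (Fin (suc k)))
allVSeqs k zero    = [] ∷ []
allVSeqs k (suc m) = concatMap (λ s → map (λ v → v ∷ s) (allFin (suc k))) (allVSeqs k m)

WalkFrom : (k : ℕ) → Fin (suc k) → List (Fin (suc k)) → Set
WalkFrom k v []       = v ≡ zero
WalkFrom k v (w ∷ ws) = Adj k v w × WalkFrom k w ws

walkFrom? : ∀ k v ws → Dec (WalkFrom k v ws)
walkFrom? k v []       = v FinP.≟ zero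
walkFrom? k v (w ∷ ws) = adj? k v w ×-dec walkFrom? k w ws

-- number of closed walks of length n at vertex 1 (v₀ = 1 fixed; v₁…vₙ enumerated)
closedWalks : (k n : ℕ) → ℕ
closedWalks k n = length (filter (walkFrom? k zero) (allVSeqs k n))

-- Fold the strip −(k+1) ≤ y ≤ k along the axis y = −1/2: the reflection y ↦ −1 − y maps the
-- strip onto itself and swaps the two admissible end heights 0 and −1, so the number of
-- admissible paths from height y depends only on |y + 1/2|. The folded heights 0,…,k are the
-- vertices of P_{k+1}; the step from 0 down to −1 folds back onto 0, which is the loop at
-- vertex 1. Both counts therefore obey the same recursion in n.
module Submission where

open import Defs
open import Data.Nat using (ℕ; _+_; _*_)
open import Relation.Binary.PropositionalEquality using (_≡_)

open import Data.Nat.Properties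
  using (_≟_; +-identityʳ; +-assoc; +-comm; +-suc; *-zeroʳ; *-identityˡ; *-identityʳ; *-distribˡ-+;
         *-distribʳ-+; <⇒≢; pred[n]≤n; 1+n≰n; m≤n⇒m<n∨m≡n; ≤-trans;
         +-commutativeSemigroup; *-commutativeSemigroup)
open import Algebra.Properties.CommutativeSemigroup +-commutativeSemigroup using (interchange)
open import Algebra.Properties.CommutativeSemigroup *-commutativeSemigroup using (x∙yz≈y∙xz)
open import Data.Bool using (true; false; if_then_else_)
open import Data.Empty using (⊥-elim)
open import Data.Fin using (Fin; zero; suc; toℕ)
open import Data.Fin.Properties using (toℕ-injective; toℕ≤pred[n]) renaming (_≟_ to _≟ᶠ_)
open import Data.Integer as ℤ using (ℤ; +_; -[1+_]; -≤-; -≤+; +≤+)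
open import Data.Integer.Properties using (+-injective)
open import Data.List using (List; []; _∷_; _++_; map; concatMap; length; filter; allFin)
open import Data.List.Properties using (map-tabulate)
open import Data.Nat.Base using (zero; suc; pred; _<_; _/_; s≤s; s<s⁻¹)
open import Data.Nat.DivMod using (+-distrib-/-∣ʳ; m*n/n≡m)
open import Data.Nat.Divisibility using (divides)
open import Data.Nat.Tactic.RingSolver using (solve-∀)
open import Data.Product using (_×_; _,_)
open import Data.Sum using (_⊎_; inj₁; inj₂; map₁)
open import Function using (_∘_; id)
open import Function.Bundles using (_⇔_; mk⇔)
open import Relation.Binary.PropositionalEquality using (refl; sym; trans; cong; cong₂; subst)
open import Relation.Nullary using (Dec; yes; no; does; ¬_)
open import Relation.Nullary.Decidable using (_×-dec_; _⊎-dec_; does-⇔; dec-true; dec-false)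
open import Relation.Unary using (Decidable)
open Relation.Binary.PropositionalEquality.≡-Reasoning

private variable
  A B P Q : Set

∑ : List A → (A → ℕ) → ℕ
∑ []       f = 0
∑ (x ∷ xs) f = f x + ∑ xs f

infix 5 ∑
syntax ∑ xs (λ x → e) = ∑[ x ∈ xs ] e

∑-cong : ∀ xs {f g : A → ℕ} → (∀ x → f x ≡ g x) → ∑ xs f ≡ ∑ xs g
∑-cong []       f≗g = refl
∑-cong (x ∷ xs) f≗g = cong₂ _+_ (f≗g x) (∑-cong xs f≗g)

∑-≡0 : ∀ xs {f : A → ℕ} → (∀ x → f x ≡ 0) → ∑ xs f ≡ 0
∑-≡0 []       f≗0 = refl
∑-≡0 (x ∷ xs) f≗0 = cong₂ _+_ (f≗0 x) (∑-≡0 xs f≗0)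

∑-++ : ∀ xs ys (f : A → ℕ) → ∑ (xs ++ ys) f ≡ ∑ xs f + ∑ ys f
∑-++ []       ys f = refl
∑-++ (x ∷ xs) ys f = trans (cong (_+_ (f x)) (∑-++ xs ys f)) (sym (+-assoc (f x) _ _))

∑-map : ∀ (g : A → B) xs (f : B → ℕ) → ∑ (map g xs) f ≡ ∑ xs (f ∘ g)
∑-map g []       f = refl
∑-map g (x ∷ xs) f = cong (_+_ (f (g x))) (∑-map g xs f)

∑-concatMap : ∀ (g : A → List B) xs (f : B → ℕ) → ∑ (concatMap g xs) f ≡ ∑[ x ∈ xs ] ∑ (g x) f
∑-concatMap g []       f = refl
∑-concatMap g (x ∷ xs) f = trans (∑-++ (g x) _ f) (cong (_+_ (∑ (g x) f)) (∑-concatMap g xs f))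

∑-distrib-+ : ∀ xs (f g : A → ℕ) → ∑[ x ∈ xs ] (f x + g x) ≡ ∑ xs f + ∑ xs g
∑-distrib-+ []       f g = refl
∑-distrib-+ (x ∷ xs) f g =
  trans (cong (_+_ (f x + g x)) (∑-distrib-+ xs f g)) (interchange (f x) (g x) (∑ xs f) (∑ xs g))

∑-*ˡ : ∀ c xs (f : A → ℕ) → ∑[ x ∈ xs ] c * f x ≡ c * ∑ xs f
∑-*ˡ c []       f = sym (*-zeroʳ c)
∑-*ˡ c (x ∷ xs) f = trans (cong (_+_ (c * f x)) (∑-*ˡ c xs f)) (sym (*-distribˡ-+ c (f x) _))

∑-comm : ∀ xs ys (F : A → B → ℕ) → ∑[ x ∈ xs ] ∑ ys (F x) ≡ ∑[ y ∈ ys ] ∑[ x ∈ xs ] F x y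
∑-comm []       ys F = sym (∑-≡0 ys (λ _ → refl))
∑-comm (x ∷ xs) ys F =
  trans (cong (_+_ (∑ ys (F x))) (∑-comm xs ys F)) (sym (∑-distrib-+ ys (F x) _))

∑-allFin-suc : ∀ m (f : Fin (suc m) → ℕ) → ∑ (allFin (suc m)) f ≡ f zero + (∑[ i ∈ allFin m ] f (suc i))
∑-allFin-suc m f =
  cong (_+_ (f zero)) (trans (cong (λ is → ∑ is f) (sym (map-tabulate id suc))) (∑-map suc (allFin m) f))

𝟙 : Dec P → ℕ
𝟙 p = if does p then 1 else 0

𝟙-cong : (p : Dec P) (q : Dec Q) → P ⇔ Q → 𝟙 p ≡ 𝟙 q
𝟙-cong p q P⇔Q = cong (λ b → if b then 1 else 0) (does-⇔ P⇔Q p q)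

𝟙-yes : (p : Dec P) → P → 𝟙 p ≡ 1
𝟙-yes p x = cong (λ b → if b then 1 else 0) (dec-true p x)

𝟙-no : (p : Dec P) → ¬ P → 𝟙 p ≡ 0
𝟙-no p ¬x = cong (λ b → if b then 1 else 0) (dec-false p ¬x)

𝟙-× : (p : Dec P) (q : Dec Q) → 𝟙 (p ×-dec q) ≡ 𝟙 p * 𝟙 q
𝟙-× p q with does p | does q
... | true  | true  = refl
... | true  | false = refl
... | false | _     = refl

𝟙-⊎ : (p : Dec P) (q : Dec Q) → ¬ (P × Q) → 𝟙 (p ⊎-dec q) ≡ 𝟙 p + 𝟙 q
𝟙-⊎ p q disjoint with p | q
... | yes x | yes y = ⊥-elim (disjoint (x , y))
... | yes _ | no _  = refl
... | no _  | yes _ = refl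
... | no _  | no _  = refl

length-filter : {P : A → Set} (P? : Decidable P) (xs : List A) →
                length (filter P? xs) ≡ ∑[ x ∈ xs ] 𝟙 (P? x)
length-filter P? []       = refl
length-filter P? (x ∷ xs) with does (P? x)
... | true  = cong suc (length-filter P? xs)
... | false = length-filter P? xs

∑-allFin-point : ∀ m c (f : ℕ → ℕ) → c < m ⊎ f c ≡ 0 →
                 ∑[ i ∈ allFin m ] 𝟙 (toℕ i ≟ c) * f (toℕ i) ≡ f c
∑-allFin-point zero    c       f (inj₂ fc≡0) = sym fc≡0
-- The indicators compute: 𝟙 (suc a ≟ 0) reduces to 0 and 𝟙 (suc a ≟ suc c) to 𝟙 (a ≟ c).
∑-allFin-point (suc m) zero    f _ = begin
  ∑[ i ∈ allFin (suc m) ] 𝟙 (toℕ i ≟ 0) * f (toℕ i) ≡⟨ ∑-allFin-suc m (λ i → 𝟙 (toℕ i ≟ 0) * f (toℕ i)) ⟩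
  f 0 + 0 + (∑[ i ∈ allFin m ] 0)                    ≡⟨ cong (_+_ (f 0 + 0)) (∑-≡0 (allFin m) (λ _ → refl)) ⟩
  f 0 + 0 + 0                                        ≡⟨ trans (+-identityʳ _) (+-identityʳ _) ⟩
  f 0                                                ∎
∑-allFin-point (suc m) (suc c) f c<m⊎fc≡0 =
  trans (∑-allFin-suc m (λ i → 𝟙 (toℕ i ≟ suc c) * f (toℕ i)))
        (∑-allFin-point m c (f ∘ suc) (map₁ s<s⁻¹ c<m⊎fc≡0))

module Paths (m : ℕ) where

  InStrip : ℤ → Set
  InStrip h = (-[1+ m ] ℤ.≤ h) × (h ℤ.≤ + m)

  inStrip? : ∀ h → Dec (InStrip h)
  inStrip? h = (-[1+ m ] ℤ.≤? h) ×-dec (h ℤ.≤? + m)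

  AtBase : ℤ → Set
  AtBase h = (h ≡ + 0) ⊎ (h ≡ -[1+ 0 ])

  atBase? : ∀ h → Dec (AtBase h)
  atBase? h = (h ℤ.≟ + 0) ⊎-dec (h ℤ.≟ -[1+ 0 ])

  Admissible : ℤ → List Step → Set
  Admissible h p = AtBase (endHeight h p) × StaysIn -[1+ m ] (+ m) h p

  admissible? : ∀ h p → Dec (Admissible h p)
  admissible? h p = atBase? (endHeight h p) ×-dec staysIn? -[1+ m ] (+ m) h p

  pathCount : ℤ → ℕ → ℕ
  pathCount h n = ∑[ p ∈ allSeqs n ] 𝟙 (admissible? h p)

  pathCount-zero : ∀ h → pathCount h 0 ≡ 𝟙 (atBase? h) * 𝟙 (inStrip? h)
  pathCount-zero h = trans (+-identityʳ _) (𝟙-× (atBase? h) (inStrip? h))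

  admissible-∷ : ∀ h s p →
    𝟙 (admissible? h (s ∷ p)) ≡ 𝟙 (inStrip? h) * 𝟙 (admissible? (h ℤ.+ stepVal s) p)
  admissible-∷ h s p = begin
    𝟙 (e ×-dec (i ×-dec t))  ≡⟨ trans (𝟙-× e (i ×-dec t)) (cong (𝟙 e *_) (𝟙-× i t)) ⟩
    𝟙 e * (𝟙 i * 𝟙 t)        ≡⟨ x∙yz≈y∙xz (𝟙 e) (𝟙 i) (𝟙 t) ⟩
    𝟙 i * (𝟙 e * 𝟙 t)        ≡⟨ cong (𝟙 i *_) (sym (𝟙-× e t)) ⟩
    𝟙 i * 𝟙 (e ×-dec t)      ∎
    where
      h′ = h ℤ.+ stepVal s
      e = atBase? (endHeight h′ p)
      i = inStrip? h
      t = staysIn? -[1+ m ] (+ m) h′ p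

  pathCount-suc : ∀ h n →
    pathCount h (suc n) ≡ 𝟙 (inStrip? h) * (pathCount (h ℤ.+ + 1) n + pathCount (h ℤ.- + 1) n)
  pathCount-suc h n = begin
    pathCount h (suc n)
      ≡⟨ ∑-concatMap _ (allSeqs n) _ ⟩
    ∑[ p ∈ allSeqs n ] (𝟙 (admissible? h (U ∷ p)) + (𝟙 (admissible? h (D ∷ p)) + 0))
      ≡⟨ ∑-cong (allSeqs n) (λ p →
           cong₂ _+_ (admissible-∷ h U p) (trans (+-identityʳ _) (admissible-∷ h D p))) ⟩
    ∑[ p ∈ allSeqs n ] (s * up p + s * down p)
      ≡⟨ ∑-distrib-+ (allSeqs n) _ _ ⟩
    (∑[ p ∈ allSeqs n ] s * up p) + (∑[ p ∈ allSeqs n ] s * down p)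
      ≡⟨ cong₂ _+_ (∑-*ˡ s (allSeqs n) up) (∑-*ˡ s (allSeqs n) down) ⟩
    s * pathCount (h ℤ.+ + 1) n + s * pathCount (h ℤ.- + 1) n
      ≡⟨ sym (*-distribˡ-+ s _ _) ⟩
    s * (pathCount (h ℤ.+ + 1) n + pathCount (h ℤ.- + 1) n)
      ∎
    where
      s = 𝟙 (inStrip? h)
      up down : List Step → ℕ
      up p = 𝟙 (admissible? (h ℤ.+ + 1) p)
      down p = 𝟙 (admissible? (h ℤ.- + 1) p)

  pathCount-outside : ∀ {h} → ¬ InStrip h → ∀ n → pathCount h n ≡ 0
  pathCount-outside {h} h∉ zero = begin
    pathCount h 0                      ≡⟨ pathCount-zero h ⟩
    𝟙 (atBase? h) * 𝟙 (inStrip? h)     ≡⟨ cong (𝟙 (atBase? h) *_) (𝟙-no (inStrip? h) h∉) ⟩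
    𝟙 (atBase? h) * 0                  ≡⟨ *-zeroʳ (𝟙 (atBase? h)) ⟩
    0                                  ∎
  pathCount-outside {h} h∉ (suc n) =
    trans (pathCount-suc h n)
          (cong (_* (pathCount (h ℤ.+ + 1) n + pathCount (h ℤ.- + 1) n)) (𝟙-no (inStrip? h) h∉))

  mirror : ℤ → ℤ
  mirror (+ i)    = -[1+ i ]
  mirror -[1+ i ] = + i

  mirror-inStrip : ∀ h → InStrip (mirror h) ⇔ InStrip h
  mirror-inStrip (+ i) =
    mk⇔ (λ { (-≤- i≤m , _) → -≤+ , +≤+ i≤m }) (λ { (_ , +≤+ i≤m) → -≤- i≤m , -≤+ })
  mirror-inStrip -[1+ i ] =
    mk⇔ (λ { (_ , +≤+ i≤m) → -≤- i≤m , -≤+ }) (λ { (-≤- i≤m , _) → -≤+ , +≤+ i≤m })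

  mirror-atBase : ∀ h → AtBase (mirror h) ⇔ AtBase h
  mirror-atBase (+ 0)        = mk⇔ (λ _ → inj₁ refl) (λ _ → inj₂ refl)
  mirror-atBase (+ suc i)    = mk⇔ (λ { (inj₁ ()) ; (inj₂ ()) }) (λ { (inj₁ ()) ; (inj₂ ()) })
  mirror-atBase -[1+ 0 ]     = mk⇔ (λ _ → inj₂ refl) (λ _ → inj₁ refl)
  mirror-atBase -[1+ suc i ] = mk⇔ (λ { (inj₁ ()) ; (inj₂ ()) }) (λ { (inj₁ ()) ; (inj₂ ()) })

  mirror-+1 : ∀ h → mirror h ℤ.+ + 1 ≡ mirror (h ℤ.- + 1)
  mirror-+1 (+ 0)     = refl
  mirror-+1 (+ suc i) = refl
  mirror-+1 -[1+ i ]  = cong +_ (+-suc i 0)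

  mirror--1 : ∀ h → mirror h ℤ.- + 1 ≡ mirror (h ℤ.+ + 1)
  mirror--1 (+ i)        = cong -[1+_] (sym (+-suc i 0))
  mirror--1 -[1+ 0 ]     = refl
  mirror--1 -[1+ suc i ] = refl

  pathCount-mirror : ∀ n h → pathCount (mirror h) n ≡ pathCount h n
  pathCount-mirror zero h = begin
    pathCount (mirror h) 0
      ≡⟨ pathCount-zero (mirror h) ⟩
    𝟙 (atBase? (mirror h)) * 𝟙 (inStrip? (mirror h))
      ≡⟨ cong₂ _*_ (𝟙-cong (atBase? (mirror h)) (atBase? h) (mirror-atBase h))
                   (𝟙-cong (inStrip? (mirror h)) (inStrip? h) (mirror-inStrip h)) ⟩
    𝟙 (atBase? h) * 𝟙 (inStrip? h)
      ≡⟨ pathCount-zero h ⟨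
    pathCount h 0
      ∎
  pathCount-mirror (suc n) h = begin
    pathCount (mirror h) (suc n)
      ≡⟨ pathCount-suc (mirror h) n ⟩
    𝟙 (inStrip? (mirror h)) * (pathCount (mirror h ℤ.+ + 1) n + pathCount (mirror h ℤ.- + 1) n)
      ≡⟨ cong₂ _*_ (𝟙-cong (inStrip? (mirror h)) (inStrip? h) (mirror-inStrip h))
                   (cong₂ _+_ (cong (λ h′ → pathCount h′ n) (mirror-+1 h))
                              (cong (λ h′ → pathCount h′ n) (mirror--1 h))) ⟩
    𝟙 (inStrip? h) * (pathCount (mirror (h ℤ.- + 1)) n + pathCount (mirror (h ℤ.+ + 1)) n)
      ≡⟨ cong (𝟙 (inStrip? h) *_)
              (trans (cong₂ _+_ (pathCount-mirror n (h ℤ.- + 1)) (pathCount-mirror n (h ℤ.+ + 1)))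
                     (+-comm (pathCount (h ℤ.- + 1) n) _)) ⟩
    𝟙 (inStrip? h) * (pathCount (h ℤ.+ + 1) n + pathCount (h ℤ.- + 1) n)
      ≡⟨ pathCount-suc h n ⟨
    pathCount h (suc n)
      ∎

  pathCount-above : ∀ i n → pathCount (+ i ℤ.+ + 1) n ≡ pathCount (+ suc i) n
  pathCount-above i n = cong (λ j → pathCount (+ j) n) (+-comm i 1)

  pathCount-below : ∀ i n → pathCount (+ i ℤ.- + 1) n ≡ pathCount (+ pred i) n
  pathCount-below zero    n = pathCount-mirror n (+ 0)
  pathCount-below (suc i) n = refl

module Walks (k : ℕ) where

  walkCount : Fin (suc k) → ℕ → ℕ
  walkCount v n = ∑[ vs ∈ allVSeqs k n ] 𝟙 (walkFrom? k v vs)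

  walkCount-suc : ∀ v n →
    walkCount v (suc n) ≡ ∑[ w ∈ allFin (suc k) ] 𝟙 (adj? k v w) * walkCount w n
  walkCount-suc v n = begin
    walkCount v (suc n)
      ≡⟨ ∑-concatMap _ (allVSeqs k n) _ ⟩
    ∑[ vs ∈ allVSeqs k n ] ∑ (map (λ w → w ∷ vs) (allFin (suc k))) (𝟙 ∘ walkFrom? k v)
      ≡⟨ ∑-cong (allVSeqs k n) (λ vs → ∑-map _ (allFin (suc k)) _) ⟩
    ∑[ vs ∈ allVSeqs k n ] ∑[ w ∈ allFin (suc k) ] 𝟙 (walkFrom? k v (w ∷ vs))
      ≡⟨ ∑-comm (allVSeqs k n) (allFin (suc k)) _ ⟩
    ∑[ w ∈ allFin (suc k) ] ∑[ vs ∈ allVSeqs k n ] 𝟙 (adj? k v w ×-dec walkFrom? k w vs)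
      ≡⟨ ∑-cong (allFin (suc k)) (λ w →
           trans (∑-cong (allVSeqs k n) (λ vs → 𝟙-× (adj? k v w) (walkFrom? k w vs)))
                 (∑-*ˡ (𝟙 (adj? k v w)) (allVSeqs k n) _)) ⟩
    ∑[ w ∈ allFin (suc k) ] 𝟙 (adj? k v w) * walkCount w n
      ∎

  -- The loop makes vertex 1 its own lower neighbour, matching pred 0 = 0.
  Adj⇔neighbour : ∀ v w → Adj k v w ⇔ (toℕ w ≡ suc (toℕ v) ⊎ toℕ w ≡ pred (toℕ v))
  Adj⇔neighbour v w = mk⇔ to (from v)
    where
      to : Adj k v w → toℕ w ≡ suc (toℕ v) ⊎ toℕ w ≡ pred (toℕ v)
      to (inj₁ w≡1+v)                = inj₁ w≡1+v
      to (inj₂ (inj₁ v≡1+w))         = inj₂ (cong pred (sym v≡1+w))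
      to (inj₂ (inj₂ (refl , refl))) = inj₂ refl
      from : ∀ v → toℕ w ≡ suc (toℕ v) ⊎ toℕ w ≡ pred (toℕ v) → Adj k v w
      from v       (inj₁ w≡1+v) = inj₁ w≡1+v
      from zero    (inj₂ w≡0) = inj₂ (inj₂ (refl , toℕ-injective w≡0))
      from (suc v) (inj₂ w≡v) = inj₂ (inj₁ (cong suc (sym w≡v)))

  adj-indicator : ∀ v w →
    𝟙 (adj? k v w) ≡ 𝟙 (toℕ w ≟ suc (toℕ v)) + 𝟙 (toℕ w ≟ pred (toℕ v))
  adj-indicator v w =
    trans (𝟙-cong (adj? k v w) (toℕ w ≟ suc (toℕ v) ⊎-dec toℕ w ≟ pred (toℕ v)) (Adj⇔neighbour v w))
          (𝟙-⊎ (toℕ w ≟ suc (toℕ v)) (toℕ w ≟ pred (toℕ v))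
               (λ (up , down) → <⇒≢ (s≤s pred[n]≤n) (trans (sym down) up)))

  ∑-neighbours : ∀ (f : ℕ → ℕ) → f (suc k) ≡ 0 → ∀ v →
    ∑[ w ∈ allFin (suc k) ] 𝟙 (adj? k v w) * f (toℕ w) ≡ f (suc (toℕ v)) + f (pred (toℕ v))
  ∑-neighbours f f[1+k]≡0 v = begin
    ∑[ w ∈ allFin (suc k) ] 𝟙 (adj? k v w) * f (toℕ w)
      ≡⟨ ∑-cong (allFin (suc k)) (λ w →
           trans (cong (_* f (toℕ w)) (adj-indicator v w))
                 (*-distribʳ-+ (f (toℕ w)) (𝟙 (toℕ w ≟ suc i)) (𝟙 (toℕ w ≟ pred i)))) ⟩
    ∑[ w ∈ allFin (suc k) ] (𝟙 (toℕ w ≟ suc i) * f (toℕ w) + 𝟙 (toℕ w ≟ pred i) * f (toℕ w))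
      ≡⟨ ∑-distrib-+ (allFin (suc k)) (λ w → 𝟙 (toℕ w ≟ suc i) * f (toℕ w))
                                      (λ w → 𝟙 (toℕ w ≟ pred i) * f (toℕ w)) ⟩
    (∑[ w ∈ allFin (suc k) ] 𝟙 (toℕ w ≟ suc i) * f (toℕ w))
      + (∑[ w ∈ allFin (suc k) ] 𝟙 (toℕ w ≟ pred i) * f (toℕ w))
      ≡⟨ cong₂ _+_ (∑-allFin-point (suc k) (suc i) f above)
                   (∑-allFin-point (suc k) (pred i) f (inj₁ (s≤s (≤-trans pred[n]≤n i≤k)))) ⟩
    f (suc i) + f (pred i)
      ∎
    where
      i = toℕ v
      i≤k = toℕ≤pred[n] v
      above : suc i < suc k ⊎ f (suc i) ≡ 0
      above with m≤n⇒m<n∨m≡n i≤k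
      ... | inj₁ i<k = inj₁ (s≤s i<k)
      ... | inj₂ i≡k = inj₂ (subst (λ j → f (suc j) ≡ 0) (sym i≡k) f[1+k]≡0)

  open Paths k

  vertex-inStrip : ∀ (v : Fin (suc k)) → InStrip (+ toℕ v)
  vertex-inStrip v = -≤+ , +≤+ (toℕ≤pred[n] v)

  vertex-atBase : ∀ (v : Fin (suc k)) → v ≡ zero ⇔ AtBase (+ toℕ v)
  vertex-atBase v = mk⇔ (λ { refl → inj₁ refl }) (λ { (inj₁ v≡0) → toℕ-injective (+-injective v≡0) })

  walkCount≡pathCount : ∀ n v → walkCount v n ≡ pathCount (+ toℕ v) n
  walkCount≡pathCount zero v = begin
    𝟙 (v ≟ᶠ zero) + 0                       ≡⟨ +-identityʳ _ ⟩
    𝟙 (v ≟ᶠ zero)                           ≡⟨ 𝟙-cong (v ≟ᶠ zero) (atBase? (+ i)) (vertex-atBase v) ⟩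
    𝟙 (atBase? (+ i))                       ≡⟨ *-identityʳ _ ⟨
    𝟙 (atBase? (+ i)) * 1                   ≡⟨ cong (𝟙 (atBase? (+ i)) *_)
                                                    (𝟙-yes (inStrip? (+ i)) (vertex-inStrip v)) ⟨
    𝟙 (atBase? (+ i)) * 𝟙 (inStrip? (+ i))  ≡⟨ pathCount-zero (+ i) ⟨
    pathCount (+ i) 0                       ∎
    where i = toℕ v
  walkCount≡pathCount (suc n) v = begin
    walkCount v (suc n)
      ≡⟨ walkCount-suc v n ⟩
    ∑[ w ∈ allFin (suc k) ] 𝟙 (adj? k v w) * walkCount w n
      ≡⟨ ∑-cong (allFin (suc k)) (λ w → cong (𝟙 (adj? k v w) *_) (walkCount≡pathCount n w)) ⟩
    ∑[ w ∈ allFin (suc k) ] 𝟙 (adj? k v w) * f (toℕ w)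
      ≡⟨ ∑-neighbours f (pathCount-outside (λ { (_ , +≤+ 1+k≤k) → 1+n≰n 1+k≤k }) n) v ⟩
    f (suc i) + f (pred i)
      ≡⟨ cong₂ _+_ (pathCount-above i n) (pathCount-below i n) ⟨
    pathCount (+ i ℤ.+ + 1) n + pathCount (+ i ℤ.- + 1) n
      ≡⟨ trans (cong (_* (pathCount (+ i ℤ.+ + 1) n + pathCount (+ i ℤ.- + 1) n))
                     (𝟙-yes (inStrip? (+ i)) (vertex-inStrip v)))
               (*-identityˡ _) ⟨
    𝟙 (inStrip? (+ i)) * (pathCount (+ i ℤ.+ + 1) n + pathCount (+ i ℤ.- + 1) n)
      ≡⟨ pathCount-suc (+ i) n ⟨
    pathCount (+ i) (suc n)
      ∎
    where
      i = toℕ v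
      f : ℕ → ℕ
      f c = pathCount (+ c) n

open Paths using (Admissible; admissible?; pathCount)
open Walks using (walkCount; walkCount≡pathCount)

[2k+1]/2≡k : ∀ k → (2 * k + 1) / 2 ≡ k
[2k+1]/2≡k k = begin
  (2 * k + 1) / 2    ≡⟨ cong (_/ 2) (2k+1≡1+k*2 k) ⟩
  (1 + k * 2) / 2    ≡⟨ +-distrib-/-∣ʳ 1 {d = 2} (divides k refl) ⟩
  k * 2 / 2          ≡⟨ m*n/n≡m k 2 ⟩
  k                  ∎
  where 2k+1≡1+k*2 : ∀ k → 2 * k + 1 ≡ 1 + k * 2
        2k+1≡1+k*2 = solve-∀

[2k+2]/2≡1+k : ∀ k → suc (2 * k + 1) / 2 ≡ suc k
[2k+2]/2≡1+k k = trans (cong (_/ 2) (2k+2≡[1+k]*2 k)) (m*n/n≡m (suc k) 2)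
  where 2k+2≡[1+k]*2 : ∀ k → suc (2 * k + 1) ≡ suc k * 2
        2k+2≡[1+k]*2 = solve-∀

InA⇔Admissible : ∀ k p → InA (2 * k + 1) p ⇔ Admissible k (+ 0) p
InA⇔Admissible k p rewrite [2k+1]/2≡k k | [2k+2]/2≡1+k k = mk⇔ id id

mainTheorem2 : (k n : ℕ) → a n (2 * k + 1) ≡ closedWalks k n
mainTheorem2 k n = begin
  a n (2 * k + 1)                            ≡⟨ length-filter (inA? (2 * k + 1)) (allSeqs n) ⟩
  ∑[ p ∈ allSeqs n ] 𝟙 (inA? (2 * k + 1) p)  ≡⟨ ∑-cong (allSeqs n) (λ p →
                                                  𝟙-cong (inA? (2 * k + 1) p) (admissible? k (+ 0) p)
                                                         (InA⇔Admissible k p)) ⟩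
  pathCount k (+ 0) n                        ≡⟨ walkCount≡pathCount k n zero ⟨
  walkCount k zero n                         ≡⟨ length-filter (walkFrom? k zero) (allVSeqs k n) ⟨
  closedWalks k n                            ∎
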